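{- Let $G=(V,E)$ be a connected finite simple graph with at least one edge. The integer $U$ returned by Phase 2 of the Enter-Exit Greedy Algorithm (EEGA) on $G$ satisfies $U\ge L$, where $L$ is the integer returned by Phase 1.
   Context: Notation: $n=|V|$; $N(x)$ is the neighbourhood of $x$, $d_x=|N(x)|$, and $d_x(A)=|N(x)\cap A|$ for $A\subseteq V$. The EEGA on input $G$ is: Phase 1. Order the vertices as $x_1,\dots,x_n$ with $d_{x_1}\ge\dots\ge d_{x_n}$; set $d_i=d_{x_i}$; let $L$ be the smallest positive integer with $d_1+\dots+d_L\ge |E|$; return $L$. Phase 2. Set $S=\{x_1,\dots,x_L\}$. (Entry loop) While there is $x\in V\setminus S$ with $d_x(V\setminus S)>0$, take the first such $x$ in the ordering and move it from $V\setminus S$ into $S$. (Exit loop) Then, while there is $y\in S$ with $d_y(V\setminus S)=0$, take the last such $y$ in the ordering and move it from $S$ into $V\setminus S$. (Final step) If $d_x(S)=0$ for every $x\in S$, set $U=\min\{|S|,n-|S|\}$, otherwise $U=|S|$; if $G$ is bipartite with bipartition $V=A\cup B$ (every edge joins $A$ and $B$), replace $U$ by $\min\{U,|A|,|B|\}$. Return $U$. -}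

module Defs where

open import Data.Nat using (ℕ; zero; suc; _+_; _∸_; _≤_; _<_; _⊔_; _⊓_; _≤ᵇ_; _<ᵇ_; _≡ᵇ_)
open import Data.Bool using (Bool; true; false; if_then_else_; not; _∧_; _∨_)
open import Data.Fin using (Fin; toℕ; _≟_)
open import Data.Fin.Permutation using (Permutation; _⟨$⟩ʳ_)
open import Data.List using (List; []; _∷_; map; allFin; findᵇ; reverse)
open import Data.Nat.ListAction using (sum)
open import Data.Bool.ListAction using (all)
open import Data.Maybe using (Maybe; just; nothing)
open import Data.Product using (Σ; _×_; ∃; ∃-syntax)
open import Relation.Binary.PropositionalEquality using (_≡_; _≢_)
open import Relation.Nullary using (¬_; does)

record Graph (n : ℕ) : Set where
  field
    adj     : Fin n → Fin n → Bool
    sym     : ∀ x y → adj x y ≡ adj y x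
    irrefl  : ∀ x → adj x x ≡ false
open Graph public

count : ∀ {n} → (Fin n → Bool) → ℕ
count {n} p = sum (map (λ i → if p i then 1 else 0) (allFin n))

deg : ∀ {n} → Graph n → Fin n → ℕ
deg G x = count (adj G x)

degIn : ∀ {n} → Graph n → Fin n → (Fin n → Bool) → ℕ
degIn G x A = count (λ y → adj G x y ∧ A y)

numEdges : ∀ {n} → Graph n → ℕ
numEdges {n} G = sum (map (λ x → count (λ y → (toℕ x <ᵇ toℕ y) ∧ adj G x y)) (allFin n))

data Reachable {n} (G : Graph n) : Fin n → Fin n → Set where
  here : ∀ {x} → Reachable G x x
  step : ∀ {x y z} → adj G x y ≡ true → Reachable G y z → Reachable G x z

Connected : ∀ {n} → Graph n → Set
Connected G = ∀ x y → Reachable G x y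

HasEdge : ∀ {n} → Graph n → Set
HasEdge G = ∃[ x ] ∃[ y ] adj G x y ≡ true

-- An ordering x_1,…,x_n of the vertices (x_{i+1} = ord ⟨$⟩ʳ i) with
-- non-increasing degrees.
DegreeOrdering : ∀ {n} → Graph n → Permutation n n → Set
DegreeOrdering G ord = ∀ i j → toℕ i ≤ toℕ j → deg G (ord ⟨$⟩ʳ j) ≤ deg G (ord ⟨$⟩ʳ i)

-- go k acc ds : k = current candidate L, acc = d_1+…+d_{k-1}, ds = d_k,…,d_n
phase1-go : ℕ → ℕ → ℕ → List ℕ → ℕ
phase1-go e k acc []       = k
phase1-go e k acc (d ∷ ds) = if e ≤ᵇ acc + d then k else phase1-go e (suc k) (acc + d) ds

phase1 : ∀ {n} → Graph n → Permutation n n → ℕ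
phase1 {n} G ord = phase1-go (numEdges G) 1 0 (map (λ i → deg G (ord ⟨$⟩ʳ i)) (allFin n))

Set' : ℕ → Set
Set' n = Fin n → Bool

insert : ∀ {n} → Fin n → Set' n → Set' n
insert x S y = if does (y ≟ x) then true else S y

remove : ∀ {n} → Fin n → Set' n → Set' n
remove x S y = if does (y ≟ x) then false else S y

ordered : ∀ {n} → Permutation n n → List (Fin n)
ordered {n} ord = map (ord ⟨$⟩ʳ_) (allFin n)

complement : ∀ {n} → Set' n → Set' n
complement S x = not (S x)

-- entry loop (fuel bounds the number of iterations; n+1 always suffices)
entryLoop : ∀ {n} → Graph n → Permutation n n → ℕ → Set' n → Set' n
entryLoop G ord zero S = S
entryLoop G ord (suc f) S with findᵇ (λ x → not (S x) ∧ (1 ≤ᵇ degIn G x (complement S))) (ordered ord)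
... | just x  = entryLoop G ord f (insert x S)
... | nothing = S

exitLoop : ∀ {n} → Graph n → Permutation n n → ℕ → Set' n → Set' n
exitLoop G ord zero S = S
exitLoop G ord (suc f) S with findᵇ (λ y → S y ∧ (degIn G y (complement S) ≡ᵇ 0)) (reverse (ordered ord))
... | just y  = exitLoop G ord f (remove y S)
... | nothing = S

initialS : ∀ {n} → Graph n → Permutation n n → Set' n
initialS G ord x = toℕ (Data.Fin.Permutation._⟨$⟩ˡ_ ord x) <ᵇ phase1 G ord

finalS : ∀ {n} → Graph n → Permutation n n → Set' n
finalS {n} G ord = exitLoop G ord (suc n) (entryLoop G ord (suc n) (initialS G ord))

-- U before the bipartite correction
U₀ : ∀ {n} → Graph n → Permutation n n → ℕ
U₀ {n} G ord =
  let S  = finalS G ord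
      s  = count S
      indep = all (λ x → if S x then degIn G x S ≡ᵇ 0 else true) (allFin n)
  in if indep then s ⊓ (n ∸ s) else s

IsBipartition : ∀ {n} → Graph n → (Fin n → Bool) → Set
IsBipartition G side = ∀ x y → adj G x y ≡ true → side x ≢ side y

Bipartite : ∀ {n} → Graph n → Set
Bipartite G = ∃[ side ] IsBipartition G side

EEGAPhase2Returns : ∀ {n} → Graph n → Permutation n n → ℕ → Set
EEGAPhase2Returns G ord U =
  (¬ Bipartite G → U ≡ U₀ G ord) ×
  (∀ side → IsBipartition G side →
     U ≡ U₀ G ord ⊓ (count side ⊓ count (λ x → not (side x))))

-- Every vertex cover C satisfies |E| ≤ Σ_{x ∈ C} d_x ≤ d_1 + … + d_{|C|}, so |C| ≥ L by
-- the minimality of L.  Phase 2 ends with a vertex cover S: after the entry loop no edge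
-- has both ends outside S, and the exit loop only removes vertices whose neighbours all
-- lie in S.  If S is independent, V ∖ S is a vertex cover too, and so are both sides of a
-- bipartition.  Hence U is a minimum of sizes of vertex covers, and U ≥ L.
module Submission where

open import Defs hiding (sym)
open import Data.Nat using (ℕ; zero; suc; _+_; _∸_; _≤_; _<_; _≤ᵇ_; _<ᵇ_; _≡ᵇ_; z≤n; s≤s; s≤s⁻¹; _≤?_)
open import Data.Nat.Properties
  using (+-0-commutativeMonoid; ≤-refl; ≤-reflexive; ≤-trans; <-≤-trans; +-mono-≤; +-mono-<;
         +-mono-<-≤; +-mono-≤-<; m≤m+n; m≤n+m; +-identityʳ; +-assoc; +-suc; ≤⇒≤ᵇ; <ᵇ⇒<; ≡ᵇ⇒≡;
         <⇒≯; <⇒≱; ≮⇒≥; m+n∸m≡n; ⊓-glb; module ≤-Reasoning)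
open import Data.Bool using (Bool; true; false; if_then_else_; not; _∧_; T)
open import Data.Bool.Properties using (T-≡; not-injective)
open import Data.Bool.ListAction using (all)
open import Data.Fin using (Fin; zero; suc; toℕ; _≟_)
open import Data.Fin.Permutation using (Permutation; _⟨$⟩ʳ_; _⟨$⟩ˡ_; inverseʳ)
open import Data.List using (_∷_; map; allFin; findᵇ; tabulate; reverse)
open import Data.List.Properties using (map-tabulate)
import Data.Nat.ListAction as List
open import Data.List.Membership.Propositional using (_∈_)
open import Data.List.Membership.Propositional.Properties using (∈-allFin; ∈-map⁺)
open import Data.List.Relation.Unary.Any using (here; there)
open import Data.List.Relation.Unary.All using (lookup)
open import Data.List.Relation.Unary.All.Properties using (all⁺)
open import Data.Maybe using (just; nothing)
open import Data.Product using (_,_)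
open import Data.Sum using (_⊎_; inj₁; inj₂; [_,_]′)
open import Data.Empty using (⊥-elim)
open import Function using (_∘_; flip; id)
open import Function.Bundles using (module Equivalence)
open import Relation.Binary.PropositionalEquality
  using (_≡_; _≢_; refl; sym; trans; cong; cong₂; subst; module ≡-Reasoning)
open import Relation.Nullary using (¬_; Dec; yes; no; contradiction)
open import Relation.Nullary.Decidable using (decidable-stable)
open import Algebra.Properties.CommutativeMonoid.Sum +-0-commutativeMonoid
  using (sum; sum-cong-≗; sum-replicate-zero; sum-remove; ∑-distrib-+; ∑-comm; sum-permute)

open Equivalence using (to; from)

adj-sym : ∀ {n} (G : Graph n) x y → adj G x y ≡ adj G y x
adj-sym = Graph.sym

sum-mono-≤ : ∀ {n} {f g : Fin n → ℕ} → (∀ i → f i ≤ g i) → sum f ≤ sum g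
sum-mono-≤ {zero}  f≤g = z≤n
sum-mono-≤ {suc n} f≤g = +-mono-≤ (f≤g zero) (sum-mono-≤ (f≤g ∘ suc))

sum-mono-< : ∀ {n} {f g : Fin n → ℕ} → (∀ i → f i ≤ g i) → ∀ i → f i < g i → sum f < sum g
sum-mono-< f≤g zero    fi<gi = +-mono-<-≤ fi<gi (sum-mono-≤ (f≤g ∘ suc))
sum-mono-< f≤g (suc i) fi<gi = +-mono-≤-< (f≤g zero) (sum-mono-< (f≤g ∘ suc) i fi<gi)

term≤sum : ∀ {n} (f : Fin n → ℕ) i → f i ≤ sum f
term≤sum {suc n} f i = ≤-trans (m≤m+n (f i) _) (≤-reflexive (sym (sum-remove f)))

sum-ones : ∀ n → sum {n} (λ _ → 1) ≡ n
sum-ones zero    = refl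
sum-ones (suc n) = cong suc (sum-ones n)

sum-tabulate : ∀ {n} (f : Fin n → ℕ) → List.sum (tabulate f) ≡ sum f
sum-tabulate {zero}  f = refl
sum-tabulate {suc n} f = cong (f zero +_) (sum-tabulate (f ∘ suc))

sum-allFin : ∀ {n} (f : Fin n → ℕ) → List.sum (map f (allFin n)) ≡ sum f
sum-allFin f = trans (cong List.sum (map-tabulate id f)) (sum-tabulate f)

sum₂ : ∀ {n} → (Fin n → Fin n → ℕ) → ℕ
sum₂ f = sum (λ x → sum (f x))

sum₂-mono-≤ : ∀ {n} {f g : Fin n → Fin n → ℕ} → (∀ x y → f x y ≤ g x y) → sum₂ f ≤ sum₂ g
sum₂-mono-≤ f≤g = sum-mono-≤ (λ x → sum-mono-≤ (f≤g x))

sum₂-distrib-+ : ∀ {n} (f g : Fin n → Fin n → ℕ) →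
                 sum₂ (λ x y → f x y + g x y) ≡ sum₂ f + sum₂ g
sum₂-distrib-+ f g = trans (sum-cong-≗ (λ x → ∑-distrib-+ (f x) (g x)))
                           (∑-distrib-+ (λ x → sum (f x)) (λ x → sum (g x)))

sum₂-transpose : ∀ {n} (f : Fin n → Fin n → ℕ) → sum₂ (flip f) ≡ sum₂ f
sum₂-transpose f = ∑-comm (flip f)

indicator : Bool → ℕ
indicator b = if b then 1 else 0

indicator-mono : ∀ {a b} → (a ≡ true → b ≡ true) → indicator a ≤ indicator b
indicator-mono {false} _   = z≤n
indicator-mono {true}  a⇒b rewrite a⇒b refl = ≤-refl

count≡sum : ∀ {n} (p : Fin n → Bool) → count p ≡ sum (indicator ∘ p)
count≡sum p = sum-allFin (indicator ∘ p)

count-pos : ∀ {n} (p : Fin n → Bool) {x} → p x ≡ true → 0 < count p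
count-pos p {x} px = begin
  1                    ≡⟨ cong indicator (sym px) ⟩
  indicator (p x)      ≤⟨ term≤sum (indicator ∘ p) x ⟩
  sum (indicator ∘ p)  ≡⟨ sym (count≡sum p) ⟩
  count p              ∎
  where open ≤-Reasoning

count≡0⇒false : ∀ {n} (p : Fin n → Bool) → count p ≡ 0 → ∀ x → p x ≡ false
count≡0⇒false p count≡0 x with p x in px
... | false = refl
... | true  = contradiction (subst (0 <_) count≡0 (count-pos p px)) λ ()

count≤n : ∀ {n} (p : Fin n → Bool) → count p ≤ n
count≤n {n} p = begin
  count p              ≡⟨ count≡sum p ⟩
  sum (indicator ∘ p)  ≤⟨ sum-mono-≤ (λ i → indicator-mono {p i} {true} (λ _ → refl)) ⟩
  sum {n} (λ _ → 1)    ≡⟨ sum-ones n ⟩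
  n                    ∎
  where open ≤-Reasoning

count-mono-< : ∀ {n} (p q : Fin n → Bool) → (∀ y → p y ≡ true → q y ≡ true) →
               ∀ x → p x ≡ false → q x ≡ true → count p < count q
count-mono-< p q p⊆q x px qx = begin-strict
  count p              ≡⟨ count≡sum p ⟩
  sum (indicator ∘ p)  <⟨ sum-mono-< (λ y → indicator-mono (p⊆q y)) x indicator-px<qx ⟩
  sum (indicator ∘ q)  ≡⟨ count≡sum q ⟨
  count q              ∎
  where
  open ≤-Reasoning
  indicator-px<qx : indicator (p x) < indicator (q x)
  indicator-px<qx rewrite px | qx = s≤s z≤n

count-complement : ∀ {n} (p : Fin n → Bool) → count (complement p) ≡ n ∸ count p
count-complement {n} p = begin
  count (complement p)                        ≡⟨ m+n∸m≡n (count p) _ ⟨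
  count p + count (complement p) ∸ count p    ≡⟨ cong (_∸ count p) partition ⟩
  n ∸ count p                                 ∎
  where
  open ≡-Reasoning
  indicator-partition : ∀ b → indicator b + indicator (not b) ≡ 1
  indicator-partition true  = refl
  indicator-partition false = refl
  partition : count p + count (complement p) ≡ n
  partition = begin
    count p + count (complement p)
      ≡⟨ cong₂ _+_ (count≡sum p) (count≡sum (complement p)) ⟩
    sum (indicator ∘ p) + sum (indicator ∘ complement p)
      ≡⟨ ∑-distrib-+ (indicator ∘ p) (indicator ∘ complement p) ⟨
    sum (λ i → indicator (p i) + indicator (not (p i)))
      ≡⟨ sum-cong-≗ (indicator-partition ∘ p) ⟩
    sum {n} (λ _ → 1)
      ≡⟨ sum-ones n ⟩
    n ∎

VertexCover : ∀ {n} → Graph n → Set' n → Set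
VertexCover G C = ∀ {x y} → adj G x y ≡ true → C x ≡ true ⊎ C y ≡ true

degreeSum : ∀ {n} → Graph n → Set' n → ℕ
degreeSum G C = sum (λ x → if C x then deg G x else 0)

adjacent⇒distinct : ∀ {n} (G : Graph n) {x y} → adj G x y ≡ true → x ≢ y
adjacent⇒distinct G {x} xy refl with trans (sym (irrefl G x)) xy
... | ()

degIn≡0⇒neighbours∉ : ∀ {n} (G : Graph n) {x} A → degIn G x A ≡ 0 →
                       ∀ {y} → adj G x y ≡ true → A y ≡ false
degIn≡0⇒neighbours∉ G {x} A degIn≡0 {y} xy
  with count≡0⇒false (λ z → adj G x z ∧ A z) degIn≡0 y
... | xy∧Ay≡false rewrite xy = xy∧Ay≡false

cover-nonempty : ∀ {n} (G : Graph n) {C} → HasEdge G → VertexCover G C → 0 < count C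
cover-nonempty G {C} (_ , _ , xy) cover = [ count-pos C , count-pos C ]′ (cover xy)

m+m≤n+n⇒m≤n : ∀ {m n} → m + m ≤ n + n → m ≤ n
m+m≤n+n⇒m≤n m+m≤n+n = ≮⇒≥ λ n<m → <⇒≱ (+-mono-< n<m n<m) m+m≤n+n

-- Summing over both orientations of every pair doubles both sides and makes the edge
-- count symmetric in its two endpoints.
module _ {n} (G : Graph n) {C : Set' n} (cover : VertexCover G C) where

  private
    forward : Fin n → Fin n → ℕ
    forward x y = indicator ((toℕ x <ᵇ toℕ y) ∧ adj G x y)

    covered : Fin n → Fin n → ℕ
    covered x y = indicator (C x ∧ adj G x y)

    edge-pair≤adjacent : ∀ x y → forward x y + forward y x ≤ indicator (adj G x y)
    edge-pair≤adjacent x y with toℕ x <ᵇ toℕ y in x<y | toℕ y <ᵇ toℕ x in y<x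
    ... | true  | true  =
      contradiction (<ᵇ⇒< (toℕ y) (toℕ x) (from T-≡ y<x)) (<⇒≯ (<ᵇ⇒< (toℕ x) (toℕ y) (from T-≡ x<y)))
    ... | true  | false = ≤-reflexive (+-identityʳ _)
    ... | false | true  = ≤-reflexive (cong indicator (adj-sym G y x))
    ... | false | false = z≤n

    adjacent≤covered-pair : ∀ x y → indicator (adj G x y) ≤ covered x y + covered y x
    adjacent≤covered-pair x y with adj G x y in xy
    ... | false = z≤n
    ... | true rewrite trans (adj-sym G y x) xy with cover xy
    ...   | inj₁ Cx rewrite Cx = s≤s z≤n
    ...   | inj₂ Cy rewrite Cy = m≤n+m 1 _

    numEdges≡sum₂ : numEdges G ≡ sum₂ forward
    numEdges≡sum₂ = trans (sum-allFin (λ x → count (λ y → (toℕ x <ᵇ toℕ y) ∧ adj G x y)))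
                          (sum-cong-≗ (λ x → count≡sum (λ y → (toℕ x <ᵇ toℕ y) ∧ adj G x y)))

    sum₂-covered≡degreeSum : sum₂ covered ≡ degreeSum G C
    sum₂-covered≡degreeSum = sum-cong-≗ row
      where
      row : ∀ x → sum (covered x) ≡ (if C x then deg G x else 0)
      row x with C x
      ... | true  = sym (count≡sum (adj G x))
      ... | false = sum-replicate-zero n

  numEdges≤degreeSum : numEdges G ≤ degreeSum G C
  numEdges≤degreeSum = m+m≤n+n⇒m≤n (begin
    numEdges G + numEdges G
      ≡⟨ cong₂ _+_ numEdges≡sum₂ (trans numEdges≡sum₂ (sym (sum₂-transpose forward))) ⟩
    sum₂ forward + sum₂ (flip forward)
      ≡⟨ sum₂-distrib-+ forward (flip forward) ⟨
    sum₂ (λ x y → forward x y + forward y x)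
      ≤⟨ sum₂-mono-≤ edge-pair≤adjacent ⟩
    sum₂ (λ x y → indicator (adj G x y))
      ≤⟨ sum₂-mono-≤ adjacent≤covered-pair ⟩
    sum₂ (λ x y → covered x y + covered y x)
      ≡⟨ sum₂-distrib-+ covered (flip covered) ⟩
    sum₂ covered + sum₂ (flip covered)
      ≡⟨ cong₂ _+_ sum₂-covered≡degreeSum (trans (sum₂-transpose covered) sum₂-covered≡degreeSum) ⟩
    degreeSum G C + degreeSum G C ∎)
    where open ≤-Reasoning

Nonincreasing : ∀ {n} → (Fin n → ℕ) → Set
Nonincreasing d = ∀ i j → toℕ i ≤ toℕ j → d j ≤ d i

-- d_1 + … + d_k, truncated at the length of the sequence
sumFirst : ∀ {n} → ℕ → (Fin n → ℕ) → ℕ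
sumFirst         zero    d = 0
sumFirst {zero}  (suc k) d = 0
sumFirst {suc n} (suc k) d = d zero + sumFirst k (d ∘ suc)

nonincreasing-tail : ∀ {n} {d : Fin (suc n) → ℕ} → Nonincreasing d → Nonincreasing (d ∘ suc)
nonincreasing-tail d↓ i j i≤j = d↓ (suc i) (suc j) (s≤s i≤j)

sumFirst-tail≤ : ∀ {n} (d : Fin (suc n) → ℕ) → Nonincreasing d → ∀ k → sumFirst k (d ∘ suc) ≤ sumFirst k d
sumFirst-tail≤         d d↓ zero    = z≤n
sumFirst-tail≤ {zero}  d d↓ (suc k) = z≤n
sumFirst-tail≤ {suc n} d d↓ (suc k) =
  +-mono-≤ (d↓ zero (suc zero) z≤n) (sumFirst-tail≤ (d ∘ suc) (nonincreasing-tail d↓) k)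

sum-selected≤sumFirst : ∀ {n} (c : Fin n → Bool) (d : Fin n → ℕ) → Nonincreasing d →
                        sum (λ i → if c i then d i else 0) ≤ sumFirst (sum (indicator ∘ c)) d
sum-selected≤sumFirst {zero}  c d d↓ = z≤n
sum-selected≤sumFirst {suc n} c d d↓
  with c zero | sum-selected≤sumFirst (c ∘ suc) (d ∘ suc) (nonincreasing-tail d↓)
... | true  | tail-bound = +-mono-≤ (≤-refl {d zero}) tail-bound
... | false | tail-bound = ≤-trans tail-bound (sumFirst-tail≤ d d↓ (sum (indicator ∘ c ∘ suc)))

degreeSequence : ∀ {n} → Graph n → Permutation n n → Fin n → ℕ
degreeSequence G ord i = deg G (ord ⟨$⟩ʳ i)

phase1-go-≤ : ∀ {n} e k acc (d : Fin n → ℕ) j → e ≤ acc + sumFirst (suc j) d →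
              phase1-go e k acc (tabulate d) ≤ k + j
phase1-go-≤ {zero}  e k acc d j _ = m≤m+n k j
phase1-go-≤ {suc n} e k acc d j e≤ with e ≤ᵇ acc + d zero in stop
... | true = m≤m+n k j
phase1-go-≤ {suc n} e k acc d zero e≤ | false =
  ⊥-elim (subst T stop (≤⇒≤ᵇ (≤-trans e≤ (≤-reflexive (cong (acc +_) (+-identityʳ (d zero)))))))
phase1-go-≤ {suc n} e k acc d (suc j) e≤ | false = begin
  phase1-go e (suc k) (acc + d zero) (tabulate (d ∘ suc))
    ≤⟨ phase1-go-≤ e (suc k) (acc + d zero) (d ∘ suc) j (≤-trans e≤ (≤-reflexive (sym (+-assoc acc _ _)))) ⟩
  suc k + j ≡⟨ +-suc k j ⟨
  k + suc j ∎
  where open ≤-Reasoning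

phase1-minimal : ∀ {n} (G : Graph n) ord {K} → 0 < K →
                 numEdges G ≤ sumFirst K (degreeSequence G ord) → phase1 G ord ≤ K
phase1-minimal G ord {suc j} _ e≤ =
  subst (λ ds → phase1-go (numEdges G) 1 0 ds ≤ suc j) (sym (map-tabulate id (degreeSequence G ord)))
        (phase1-go-≤ (numEdges G) 1 0 (degreeSequence G ord) j e≤)

cover-size-bound : ∀ {n} (G : Graph n) ord → HasEdge G → DegreeOrdering G ord →
                   ∀ {C} → VertexCover G C → phase1 G ord ≤ count C
cover-size-bound G ord hasEdge d↓ {C} cover =
  phase1-minimal G ord (cover-nonempty G hasEdge cover) (begin
    numEdges G
      ≤⟨ numEdges≤degreeSum G cover ⟩
    degreeSum G C
      ≡⟨ sum-permute (λ x → if C x then deg G x else 0) ord ⟩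
    sum (λ i → if C (ord ⟨$⟩ʳ i) then degreeSequence G ord i else 0)
      ≤⟨ sum-selected≤sumFirst (C ∘ (ord ⟨$⟩ʳ_)) (degreeSequence G ord) d↓ ⟩
    sumFirst (sum (indicator ∘ C ∘ (ord ⟨$⟩ʳ_))) (degreeSequence G ord)
      ≡⟨ cong (λ k → sumFirst k (degreeSequence G ord)) count-permute ⟨
    sumFirst (count C) (degreeSequence G ord) ∎)
  where
  open ≤-Reasoning
  count-permute : count C ≡ sum (indicator ∘ C ∘ (ord ⟨$⟩ʳ_))
  count-permute = trans (count≡sum C) (sum-permute (indicator ∘ C) ord)

findᵇ-just : ∀ {A : Set} (p : A → Bool) xs {x} → findᵇ p xs ≡ just x → p x ≡ true
findᵇ-just p (y ∷ xs) found with p y in py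
findᵇ-just p (y ∷ xs) refl  | true  = py
findᵇ-just p (y ∷ xs) found | false = findᵇ-just p xs found

findᵇ-nothing : ∀ {A : Set} (p : A → Bool) xs → findᵇ p xs ≡ nothing → ∀ {y} → y ∈ xs → p y ≡ false
findᵇ-nothing p (x ∷ xs) none y∈ with p x in px
findᵇ-nothing p (x ∷ xs) ()   y∈          | true
findᵇ-nothing p (x ∷ xs) none (here refl) | false = px
findᵇ-nothing p (x ∷ xs) none (there y∈)  | false = findᵇ-nothing p xs none y∈

all-sound : ∀ {A : Set} (p : A → Bool) {xs} → all p xs ≡ true → ∀ {x} → x ∈ xs → p x ≡ true
all-sound p {xs} all≡true x∈xs = to T-≡ (lookup (all⁺ p xs (from T-≡ all≡true)) x∈xs)

∧-elimˡ : ∀ {a b} → a ∧ b ≡ true → a ≡ true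
∧-elimˡ {true} _ = refl

∧-elimʳ : ∀ {a b} → a ∧ b ≡ true → b ≡ true
∧-elimʳ {true} b≡true = b≡true

1≤ᵇ≡false⇒≡0 : ∀ {k} → (1 ≤ᵇ k) ≡ false → k ≡ 0
1≤ᵇ≡false⇒≡0 {zero} _ = refl

∈-ordered : ∀ {n} (ord : Permutation n n) x → x ∈ ordered ord
∈-ordered ord x = subst (_∈ ordered ord) (inverseʳ ord) (∈-map⁺ (ord ⟨$⟩ʳ_) (∈-allFin (ord ⟨$⟩ˡ x)))

complement-insert⊆complement : ∀ {n} x (S : Set' n) y → complement (insert x S) y ≡ true → complement S y ≡ true
complement-insert⊆complement x S y y∉insert with y ≟ x
complement-insert⊆complement x S y ()       | yes _
complement-insert⊆complement x S y y∉insert | no  _ = y∉insert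

insert-self : ∀ {n} x (S : Set' n) → insert x S x ≡ true
insert-self x S with x ≟ x
... | yes _   = refl
... | no  x≢x = contradiction refl x≢x

remove-other : ∀ {n} {x y} (S : Set' n) → x ≢ y → remove y S x ≡ S x
remove-other {x = x} {y} S x≢y with x ≟ y
... | yes x≡y = contradiction x≡y x≢y
... | no  _   = refl

count-complement-insert : ∀ {n} {x} (S : Set' n) → S x ≡ false →
                          count (complement (insert x S)) < count (complement S)
count-complement-insert {x = x} S Sx =
  count-mono-< (complement (insert x S)) (complement S) (complement-insert⊆complement x S)
               x (cong not (insert-self x S)) (cong not Sx)

remove-preserves-cover : ∀ {n} (G : Graph n) {S y} → VertexCover G S →
                         (∀ {z} → adj G y z ≡ true → S z ≡ true) → VertexCover G (remove y S)
remove-preserves-cover G {S} {y} cover nbrs∈S {a} {b} ab = by-cases (a ≟ y) (b ≟ y)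
  where
  by-cases : Dec (a ≡ y) → Dec (b ≡ y) → remove y S a ≡ true ⊎ remove y S b ≡ true
  by-cases (yes refl) _          = inj₂ (trans (remove-other S (adjacent⇒distinct G ab ∘ sym)) (nbrs∈S ab))
  by-cases (no  a≢y)  (yes refl) = inj₁ (trans (remove-other S a≢y) (nbrs∈S (trans (adj-sym G b a) ab)))
  by-cases (no  a≢y)  (no  b≢y)  =
    [ inj₁ ∘ trans (remove-other S a≢y) , inj₂ ∘ trans (remove-other S b≢y) ]′ (cover ab)

module _ {n} (G : Graph n) (ord : Permutation n n) where

  entryLoop-cover : ∀ f S → count (complement S) < f → VertexCover G (entryLoop G ord f S)
  entryLoop-cover (suc f) S bound
    with findᵇ (λ x → not (S x) ∧ (1 ≤ᵇ degIn G x (complement S))) (ordered ord) in found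
  ... | just x = entryLoop-cover f (insert x S) (<-≤-trans (count-complement-insert S Sx) (s≤s⁻¹ bound))
    where
    Sx : S x ≡ false
    Sx = not-injective (∧-elimˡ (findᵇ-just _ (ordered ord) found))
  ... | nothing = cover
    where
    cover : VertexCover G S
    cover {x} {y} xy with S x | findᵇ-nothing _ (ordered ord) found (∈-ordered ord x)
    ... | true  | _          = inj₁ refl
    ... | false | not-entering =
      inj₂ (not-injective (degIn≡0⇒neighbours∉ G (complement S) (1≤ᵇ≡false⇒≡0 not-entering) xy))

  exitLoop-cover : ∀ f S → VertexCover G S → VertexCover G (exitLoop G ord f S)
  exitLoop-cover zero    S cover = cover
  exitLoop-cover (suc f) S cover
    with findᵇ (λ y → S y ∧ (degIn G y (complement S) ≡ᵇ 0)) (reverse (ordered ord)) in found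
  ... | nothing = cover
  ... | just y  = exitLoop-cover f (remove y S) (remove-preserves-cover G cover nbrs∈S)
    where
    nbrs∈S : ∀ {z} → adj G y z ≡ true → S z ≡ true
    nbrs∈S yz = not-injective (degIn≡0⇒neighbours∉ G (complement S)
                  (≡ᵇ⇒≡ _ 0 (from T-≡ (∧-elimʳ (findᵇ-just _ (reverse (ordered ord)) found)))) yz)

  finalS-cover : VertexCover G (finalS G ord)
  finalS-cover = exitLoop-cover (suc n) _ (entryLoop-cover (suc n) (initialS G ord) (s≤s (count≤n _)))

independent⇒complement-cover : ∀ {n} (G : Graph n) (S : Set' n) →
  all (λ x → if S x then degIn G x S ≡ᵇ 0 else true) (allFin n) ≡ true → VertexCover G (complement S)
independent⇒complement-cover G S independent {x} xy
  with S x | all-sound _ independent (∈-allFin x)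
... | false | _        = inj₁ refl
... | true  | isolated = inj₂ (cong not (degIn≡0⇒neighbours∉ G S (≡ᵇ⇒≡ _ 0 (from T-≡ isolated)) xy))

bipartition-side-cover : ∀ {n} (G : Graph n) {side} → IsBipartition G side → VertexCover G side
bipartition-side-cover G {side} bipartition {x} {y} xy with side x in sx | side y in sy
... | true  | _     = inj₁ refl
... | false | true  = inj₂ refl
... | false | false = contradiction (trans sx (sym sy)) (bipartition x y xy)

bipartition-complement : ∀ {n} (G : Graph n) {side} → IsBipartition G side → IsBipartition G (complement side)
bipartition-complement G bipartition x y xy = bipartition x y xy ∘ not-injective

phase1≤U₀ : ∀ {n} (G : Graph n) ord → HasEdge G → DegreeOrdering G ord → phase1 G ord ≤ U₀ G ord
phase1≤U₀ {n} G ord hasEdge d↓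
  with all (λ x → if finalS G ord x then degIn G x (finalS G ord) ≡ᵇ 0 else true) (allFin n) in independent
... | false = cover-size-bound G ord hasEdge d↓ (finalS-cover G ord)
... | true  = ⊓-glb (cover-size-bound G ord hasEdge d↓ (finalS-cover G ord))
                    (subst (phase1 G ord ≤_) (count-complement (finalS G ord))
                      (cover-size-bound G ord hasEdge d↓ (independent⇒complement-cover G (finalS G ord) independent)))

-- Whether G is bipartite is not decided: since L ≤ U is
-- decidable, it suffices to refute L > U, which forces G to be non-bipartite.
proposition4p4 : (n : ℕ) (G : Graph n) (ord : Permutation n n) →
    Connected G → HasEdge G → DegreeOrdering G ord →
    (U : ℕ) → EEGAPhase2Returns G ord U → phase1 G ord ≤ U
proposition4p4 n G ord _ hasEdge d↓ U (U-general , U-bipartite) =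
  decidable-stable (phase1 G ord ≤? U) λ L≰U →
    L≰U (subst (phase1 G ord ≤_) (sym (U-general (not-bipartite L≰U))) (phase1≤U₀ G ord hasEdge d↓))
  where
  bound : ∀ {C} → VertexCover G C → phase1 G ord ≤ count C
  bound = cover-size-bound G ord hasEdge d↓
  not-bipartite : ¬ (phase1 G ord ≤ U) → ¬ Bipartite G
  not-bipartite L≰U (side , bipartition) = L≰U (subst (phase1 G ord ≤_) (sym (U-bipartite side bipartition))
    (⊓-glb (phase1≤U₀ G ord hasEdge d↓)
           (⊓-glb (bound (bipartition-side-cover G bipartition))
                  (bound (bipartition-side-cover G (bipartition-complement G bipartition))))))
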